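{- For the directed cycle $C_n=(v_1,v_2,\dots,v_n,v_1)$ with $n\ge 3$, $\gamma_{oso}(C_n)=\lceil 2n/3\rceil$.
   Context: For a digraph $D=(V,A)$ and $v\in V$, $N^-(v)=\{w: wv\in A\}$. A set $S\subseteq V$ is out-dominating if every $v\in V\setminus S$ has an in-neighbor in $S$. $S$ is an out-secure out-dominating set (OSODS) if $S$ is out-dominating and for every $v\in V\setminus S$ there is $u\in N^-(v)\cap S$ such that $(S\setminus\{u\})\cup\{v\}$ is out-dominating. $\gamma_{oso}(D)$ is the minimum size of an OSODS of $D$. -}

module Defs where

open import Data.Nat using (ℕ; suc; _≤_; _%_; _/_; _+_; _*_; NonZero)
open import Data.Fin using (Fin; toℕ)
open import Data.Fin.Subset using (Subset; _∈_; _∉_; _∪_; ⁅_⁆; ∣_∣)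
open import Data.Fin.Subset using () renaming (_─_ to _∖_)
open import Data.Product using (Σ; _×_; ∃; ∃-syntax; _,_)
open import Relation.Binary.PropositionalEquality using (_≡_)

record Digraph : Set₁ where
  field
    n   : ℕ
    Arc : Fin n → Fin n → Set

module _ (D : Digraph) where
  open Digraph D

  OutDominating : Subset n → Set
  OutDominating S = ∀ v → v ∉ S → ∃[ w ] (Arc w v × w ∈ S)

  OSODS : Subset n → Set
  OSODS S = OutDominating S ×
    (∀ v → v ∉ S → ∃[ u ] (Arc u v × u ∈ S × OutDominating ((S ∖ ⁅ u ⁆) ∪ ⁅ v ⁆)))

  IsGammaOSO : ℕ → Set
  IsGammaOSO k = (∃[ S ] (OSODS S × ∣ S ∣ ≡ k)) × (∀ S → OSODS S → k ≤ ∣ S ∣)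

cycle : (n : ℕ) → .{{NonZero n}} → Digraph
cycle n = record { n = n ; Arc = λ i j → toℕ j ≡ suc (toℕ i) % n }

ceil3 : ℕ → ℕ
ceil3 m = (m + 2) / 3

module Submission where

open import Defs
open import Data.Nat using (ℕ; zero; suc; _+_; _*_; _/_; _%_; _≤_; _<_; s≤s; z≤n; NonZero)
open import Data.Nat.Properties
  using (1+n≢n; 0≢1+n; 1+n≢0; suc-injective; m≤n⇒m<n∨m≡n; ≤-refl; ≤-pred; m≤n+m; m≤m+n;
         +-comm; +-assoc; +-identityʳ; *-comm; *-distribˡ-+; +-mono-≤; +-monoʳ-≤;
         +-0-commutativeMonoid; module ≤-Reasoning)
open import Data.Nat.DivMod using (m<n⇒m%n≡m; n%n≡0; m<n*o⇒m/o<n; +-distrib-/-∣ʳ)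
open import Data.Nat.Divisibility using (n∣m*n)
open import Data.Bool using (Bool; true; false; if_then_else_)
open import Data.Fin using (Fin; toℕ; fromℕ; inject₁; _≟_) renaming (zero to fz; suc to fs)
open import Data.Fin.Properties using (toℕ-injective; toℕ-inject₁; toℕ-fromℕ; toℕ<n; inject₁-injective; fromℕ≢inject₁)
open import Data.Fin.Subset using (Subset; inside; outside; _∈_; _∉_; _∪_; _-_; ⁅_⁆; ∣_∣)
open import Data.Fin.Subset.Properties
  using (_∈?_; x∈⁅x⁆; x∈⁅y⁆⇒x≡y; x∈p∪q⁻; x∈p∪q⁺; p─q⊆p; x∈p∧x≢y⇒x∈p-y)
open import Data.Vec using ([]; _∷_; here; there; lookup; tabulate)
open import Data.Vec.Properties using (lookup⇒[]=; []=⇒lookup; lookup∘tabulate)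
open import Algebra.Properties.CommutativeMonoid.Sum +-0-commutativeMonoid
  using (sum; ∑-distrib-+; sum-init-last)
open import Data.Product using (_×_; _,_; proj₁; proj₂)
open import Data.Sum using (_⊎_; inj₁; inj₂)
open import Function using (_∘_)
open import Relation.Nullary using (yes; no; contradiction)
open import Relation.Binary.PropositionalEquality

-- On C_n the only in-neighbour of v is prev v.  So a vertex v ∉ S forces prev v ∈ S,
-- and after exchanging prev v for v the vertex prev v can only be dominated by
-- prev (prev v); for n ≥ 3 this shows that S is an OSODS iff every v ∉ S has
-- prev v, prev (prev v) ∈ S.  Each of the n windows {v, prev v, prev (prev v)} then
-- holds at least two members of S, and every vertex lies in exactly three windows,
-- so 2n ≤ 3|S|.  The vertices whose index is not 2 mod 3 attain ⌈2n/3⌉.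

private
  variable
    m : ℕ

prev : Fin (suc m) → Fin (suc m)
prev {m} fz = fromℕ m
prev (fs i) = inject₁ i

prev-injective : (i j : Fin (suc m)) → prev i ≡ prev j → i ≡ j
prev-injective fz     fz     _ = refl
prev-injective fz     (fs j) e = contradiction e fromℕ≢inject₁
prev-injective (fs i) fz     e = contradiction (sym e) fromℕ≢inject₁
prev-injective (fs i) (fs j) e = cong fs (inject₁-injective e)

prev≢ : (v : Fin (2 + m)) → prev v ≢ v
prev≢ fz     ()
prev≢ (fs i) e = 1+n≢n (sym (trans (sym (toℕ-inject₁ i)) (cong toℕ e)))

prev²≢ : (v : Fin (3 + m)) → prev (prev v) ≢ v
prev²≢ fz          ()
prev²≢ (fs fz)     ()
prev²≢ (fs (fs i)) e = n≢2+n (trans (sym (trans (toℕ-inject₁ (inject₁ i)) (toℕ-inject₁ i))) (cong toℕ e))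
  where
  n≢2+n : ∀ {n} → n ≢ 2 + n
  n≢2+n ()

cycle-arc-prev : (v : Fin (suc m)) → Digraph.Arc (cycle (suc m)) (prev v) v
cycle-arc-prev {m} fz     rewrite toℕ-fromℕ m = sym (n%n≡0 (suc m))
cycle-arc-prev     (fs i) rewrite toℕ-inject₁ i = sym (m<n⇒m%n≡m (s≤s (toℕ<n i)))

cycle-arc⇒≡prev : (w v : Fin (suc m)) → Digraph.Arc (cycle (suc m)) w v → w ≡ prev v
cycle-arc⇒≡prev {m} w v arc = toℕ-injective (cases v (m≤n⇒m<n∨m≡n (toℕ<n w)) arc)
  where
  cases : ∀ v → suc (toℕ w) < suc m ⊎ suc (toℕ w) ≡ suc m →
          toℕ v ≡ suc (toℕ w) % suc m → toℕ w ≡ toℕ (prev v)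
  cases fz     (inj₁ w<m) arc = contradiction (trans arc (m<n⇒m%n≡m w<m)) 0≢1+n
  cases (fs i) (inj₁ w<m) arc =
    trans (suc-injective (sym (trans arc (m<n⇒m%n≡m w<m)))) (sym (toℕ-inject₁ i))
  cases fz     (inj₂ w≡m) _   = trans (suc-injective w≡m) (sym (toℕ-fromℕ m))
  cases (fs i) (inj₂ w≡m) arc =
    contradiction (trans arc (trans (cong (_% suc m) w≡m) (n%n≡0 (suc m)))) 1+n≢0

x∉p-x : ∀ {n} (p : Subset n) x → x ∉ p - x
x∉p-x (inside  ∷ p) fz     ()
x∉p-x (outside ∷ p) fz     ()
x∉p-x (_       ∷ p) (fs x) (there x∈) = x∉p-x p x x∈

exchange : ∀ {n} → Subset n → Fin n → Fin n → Subset n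
exchange S u v = (S - u) ∪ ⁅ v ⁆

module _ {n} {S : Subset n} {u v : Fin n} where

  ∈-exchange⁺ : ∀ {x} → x ∈ S → x ≢ u → x ∈ exchange S u v
  ∈-exchange⁺ x∈S x≢u = x∈p∪q⁺ (inj₁ (x∈p∧x≢y⇒x∈p-y x∈S x≢u))

  ∈-exchange⁻ : ∀ {x} → x ∈ exchange S u v → x ∈ S ⊎ x ≡ v
  ∈-exchange⁻ x∈ with x∈p∪q⁻ (S - u) ⁅ v ⁆ x∈
  ... | inj₁ x∈S-u = inj₁ (p─q⊆p S ⁅ u ⁆ x∈S-u)
  ... | inj₂ x∈⁅v⁆ = inj₂ (x∈⁅y⁆⇒x≡y v x∈⁅v⁆)

  v∈exchange : v ∈ exchange S u v
  v∈exchange = x∈p∪q⁺ (inj₂ (x∈⁅x⁆ v))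

  u∉exchange : u ≢ v → u ∉ exchange S u v
  u∉exchange u≢v u∈ with x∈p∪q⁻ (S - u) ⁅ v ⁆ u∈
  ... | inj₁ u∈S-u = x∉p-x S u u∈S-u
  ... | inj₂ u∈⁅v⁆ = u≢v (x∈⁅y⁆⇒x≡y v u∈⁅v⁆)

Guarded : Subset (suc m) → Set
Guarded S = ∀ v → v ∉ S → prev v ∈ S × prev (prev v) ∈ S

exchange-dominating⇒prev²∈ : (S : Subset (3 + m)) (v : Fin (3 + m)) →
  OutDominating (cycle (3 + m)) (exchange S (prev v) v) → prev (prev v) ∈ S
exchange-dominating⇒prev²∈ S v dominating
  with dominating (prev v) (u∉exchange (prev≢ v))
... | w , arc , w∈ with cycle-arc⇒≡prev w (prev v) arc
... | refl with ∈-exchange⁻ w∈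
...   | inj₁ w∈S = w∈S
...   | inj₂ w≡v = contradiction w≡v (prev²≢ v)

osods⇒guarded : (S : Subset (3 + m)) → OSODS (cycle (3 + m)) S → Guarded S
osods⇒guarded S (dominating , secure) v v∉S with dominating v v∉S | secure v v∉S
... | w , arc , w∈S | u , arc′ , _ , dominating′ =
  subst (_∈ S) (cycle-arc⇒≡prev w v arc) w∈S ,
  exchange-dominating⇒prev²∈ S v
    (subst (λ u → OutDominating _ (exchange S u v)) (cycle-arc⇒≡prev u v arc′) dominating′)

guarded⇒dominating : (S : Subset (suc m)) → Guarded S → OutDominating (cycle (suc m)) S
guarded⇒dominating S guarded v v∉S = prev v , cycle-arc-prev v , proj₁ (guarded v v∉S)

guarded⇒exchange-dominating : (S : Subset (2 + m)) → Guarded S →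
  ∀ v → v ∉ S → OutDominating (cycle (2 + m)) (exchange S (prev v) v)
guarded⇒exchange-dominating S guarded v v∉S w w∉S′ = prev w , cycle-arc-prev w , prev-w∈
  where
  prev-w∈ : prev w ∈ exchange S (prev v) v
  prev-w∈ with w ≟ v | w ≟ prev v
  ... | yes refl | _        = contradiction v∈exchange w∉S′
  ... | no _     | yes refl = ∈-exchange⁺ (proj₂ (guarded v v∉S)) (prev≢ (prev v))
  ... | no w≢v   | no w≢pv with w ∈? S
  ...   | yes w∈S = contradiction (∈-exchange⁺ w∈S w≢pv) w∉S′
  ...   | no w∉S  = ∈-exchange⁺ (proj₁ (guarded w w∉S)) (w≢v ∘ prev-injective w v)

guarded⇒osods : (S : Subset (2 + m)) → Guarded S → OSODS (cycle (2 + m)) S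
guarded⇒osods S guarded =
  guarded⇒dominating S guarded ,
  λ v v∉S → prev v , cycle-arc-prev v , proj₁ (guarded v v∉S) ,
            guarded⇒exchange-dominating S guarded v v∉S

indicator : ∀ {n} → Subset n → Fin n → ℕ
indicator S x = if lookup S x then 1 else 0

module _ {n} {S : Subset n} {x : Fin n} where

  indicator-∈ : x ∈ S → indicator S x ≡ 1
  indicator-∈ x∈S rewrite []=⇒lookup x∈S = refl

  indicator-∉ : x ∉ S → indicator S x ≡ 0
  indicator-∉ x∉S with lookup S x in eq
  ... | true  = contradiction (lookup⇒[]= x S eq) x∉S
  ... | false = refl

∣S∣≡sum-indicator : ∀ {n} (S : Subset n) → ∣ S ∣ ≡ sum (indicator S)
∣S∣≡sum-indicator []            = refl
∣S∣≡sum-indicator (inside  ∷ S) = cong suc (∣S∣≡sum-indicator S)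
∣S∣≡sum-indicator (outside ∷ S) = ∣S∣≡sum-indicator S

sum-mono-≤ : ∀ {n} {f g : Fin n → ℕ} → (∀ i → f i ≤ g i) → sum f ≤ sum g
sum-mono-≤ {zero}  f≤g = z≤n
sum-mono-≤ {suc n} f≤g = +-mono-≤ (f≤g fz) (sum-mono-≤ (f≤g ∘ fs))

sum-const : ∀ n c → sum {n} (λ _ → c) ≡ n * c
sum-const zero    c = refl
sum-const (suc n) c = cong (c +_) (sum-const n c)

sum-∘prev : (f : Fin (suc m) → ℕ) → sum (f ∘ prev) ≡ sum f
sum-∘prev {m} f = trans (+-comm (f (fromℕ m)) (sum (f ∘ inject₁))) (sym (sum-init-last f))

module _ (S : Subset (suc m)) (guarded : Guarded S) where

  private
    𝟙 : Fin (suc m) → ℕ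
    𝟙 = indicator S

  guarded⇒window : ∀ v → 2 ≤ 𝟙 v + 𝟙 (prev v) + 𝟙 (prev (prev v))
  guarded⇒window v with v ∈? S | prev v ∈? S
  ... | no v∉S | _
    rewrite indicator-∈ (proj₁ (guarded v v∉S)) | indicator-∈ (proj₂ (guarded v v∉S))
    = subst (2 ≤_) (sym (+-assoc (𝟙 v) 1 1)) (m≤n+m 2 (𝟙 v))
  ... | yes v∈S | yes pv∈S rewrite indicator-∈ v∈S | indicator-∈ pv∈S = m≤m+n 2 _
  ... | yes v∈S | no pv∉S
    rewrite indicator-∈ v∈S | indicator-∉ pv∉S | indicator-∈ (proj₁ (guarded (prev v) pv∉S))
    = ≤-refl

  guarded⇒2n≤3∣S∣ : 2 * suc m ≤ 3 * ∣ S ∣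
  guarded⇒2n≤3∣S∣ = begin
    2 * suc m                                     ≡⟨ *-comm 2 (suc m) ⟩
    suc m * 2                                     ≡⟨ sum-const (suc m) 2 ⟨
    sum {suc m} (λ _ → 2)                         ≤⟨ sum-mono-≤ guarded⇒window ⟩
    sum (λ v → 𝟙 v + 𝟙 (prev v) + 𝟙 (prev (prev v)))
      ≡⟨ ∑-distrib-+ (λ v → 𝟙 v + 𝟙 (prev v)) (𝟙 ∘ prev ∘ prev) ⟩
    sum (λ v → 𝟙 v + 𝟙 (prev v)) + sum (𝟙 ∘ prev ∘ prev)
      ≡⟨ cong (_+ sum (𝟙 ∘ prev ∘ prev)) (∑-distrib-+ 𝟙 (𝟙 ∘ prev)) ⟩
    sum 𝟙 + sum (𝟙 ∘ prev) + sum (𝟙 ∘ prev ∘ prev)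
      ≡⟨ cong₂ (λ a b → sum 𝟙 + a + b) (sum-∘prev 𝟙) (trans (sum-∘prev (𝟙 ∘ prev)) (sum-∘prev 𝟙)) ⟩
    sum 𝟙 + sum 𝟙 + sum 𝟙                         ≡⟨ triple (sum 𝟙) ⟩
    3 * sum 𝟙                                     ≡⟨ cong (3 *_) (∣S∣≡sum-indicator S) ⟨
    3 * ∣ S ∣                                     ∎
    where
    open ≤-Reasoning
    triple : ∀ c → c + c + c ≡ 3 * c
    triple c = trans (+-assoc c c c) (cong (λ k → c + (c + k)) (sym (+-identityʳ c)))

ceil3-least : ∀ {k s} → k ≤ 3 * s → ceil3 k ≤ s
ceil3-least {k} {s} k≤3s = ≤-pred (m<n*o⇒m/o<n k+2<[1+s]*3)
  where
  k+2<[1+s]*3 : k + 2 < suc s * 3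
  k+2<[1+s]*3 = subst (_< suc s * 3) (+-comm 2 k) (+-monoʳ-≤ 3 (subst (k ≤_) (*-comm 3 s) k≤3s))

ceil3-6+ : ∀ k → ceil3 (6 + k) ≡ 2 + ceil3 k
ceil3-6+ k = begin
  (6 + k + 2) / 3       ≡⟨ cong (_/ 3) (+-comm 6 (k + 2)) ⟩
  (k + 2 + 2 * 3) / 3   ≡⟨ +-distrib-/-∣ʳ (k + 2) (n∣m*n 2) ⟩
  ceil3 k + 2           ≡⟨ +-comm (ceil3 k) 2 ⟩
  2 + ceil3 k           ∎
  where open ≡-Reasoning

notTwoMod3 : ℕ → Bool
notTwoMod3 0                   = true
notTwoMod3 1                   = true
notTwoMod3 2                   = false
notTwoMod3 (suc (suc (suc k))) = notTwoMod3 k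

notTwoMod3-gap : ∀ k → notTwoMod3 (2 + k) ≡ false → notTwoMod3 (1 + k) ≡ true × notTwoMod3 k ≡ true
notTwoMod3-gap 0                   _ = refl , refl
notTwoMod3-gap (suc (suc (suc k))) e = notTwoMod3-gap k e

twoOfThree : ∀ n → Subset n
twoOfThree n = tabulate (notTwoMod3 ∘ toℕ)

∣twoOfThree∣ : ∀ n → ∣ twoOfThree n ∣ ≡ ceil3 (2 * n)
∣twoOfThree∣ 0                   = refl
∣twoOfThree∣ 1                   = refl
∣twoOfThree∣ 2                   = refl
∣twoOfThree∣ (suc (suc (suc n))) = begin
  2 + ∣ twoOfThree n ∣   ≡⟨ cong (2 +_) (∣twoOfThree∣ n) ⟩
  2 + ceil3 (2 * n)      ≡⟨ ceil3-6+ (2 * n) ⟨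
  ceil3 (6 + 2 * n)      ≡⟨ cong ceil3 (*-distribˡ-+ 2 3 n) ⟨
  ceil3 (2 * (3 + n))    ∎
  where open ≡-Reasoning

module _ {n} {x : Fin n} where

  ∈twoOfThree : notTwoMod3 (toℕ x) ≡ true → x ∈ twoOfThree n
  ∈twoOfThree e = lookup⇒[]= x (twoOfThree n) (trans (lookup∘tabulate (notTwoMod3 ∘ toℕ) x) e)

  ∉twoOfThree : x ∉ twoOfThree n → notTwoMod3 (toℕ x) ≡ false
  ∉twoOfThree x∉ with notTwoMod3 (toℕ x) in eq
  ... | true  = contradiction (∈twoOfThree eq) x∉
  ... | false = refl

twoOfThree-guarded : Guarded (twoOfThree (suc m))
twoOfThree-guarded fz          v∉ = contradiction (∈twoOfThree refl) v∉
twoOfThree-guarded (fs fz)     v∉ = contradiction (∈twoOfThree refl) v∉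
twoOfThree-guarded (fs (fs i)) v∉ with notTwoMod3-gap (toℕ i) (∉twoOfThree v∉)
... | i+1∈ , i∈ =
  ∈twoOfThree (subst (λ k → notTwoMod3 (suc k) ≡ true) (sym (toℕ-inject₁ i)) i+1∈) ,
  ∈twoOfThree (subst (λ k → notTwoMod3 k ≡ true) (sym toℕ-inject₁²) i∈)
  where
  toℕ-inject₁² : toℕ (inject₁ (inject₁ i)) ≡ toℕ i
  toℕ-inject₁² = trans (toℕ-inject₁ (inject₁ i)) (toℕ-inject₁ i)

proposition2p9 : (n : ℕ) → .{{_ : NonZero n}} → 3 ≤ n → IsGammaOSO (cycle n) (ceil3 (2 * n))
proposition2p9 (suc (suc (suc m))) (s≤s (s≤s (s≤s z≤n))) =
  (twoOfThree n , guarded⇒osods (twoOfThree n) twoOfThree-guarded , ∣twoOfThree∣ n) ,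
  λ S osods → ceil3-least (guarded⇒2n≤3∣S∣ S (osods⇒guarded S osods))
  where
  n : ℕ
  n = 3 + m
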